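{- Let $k$ be even and let $G$ be the $k$-uniform tight cycle on $n\ge k+1$ vertices: vertex set $\mathbb Z_n$ and edges $\{j+1,\dots,j+k\}$ (mod $n$) for $j=0,\dots,n-1$ (so the number of edges is $m=n$). Then $G$ is regular. Write $k=2^{t_0}(2l_0+1)$ with nonnegative integers $t_0,l_0$. Then $G$ is odd-bipartite if and only if $m=n$ is a multiple of $2^{t_0}$.
   Context: A tight cycle is the $s$-cycle with $s=k-1$. A hypergraph is regular if all vertices have the same degree. A $k$-uniform hypergraph $G=(V,E)$ with $k$ even is odd-bipartite if either $E=\emptyset$ or there is a partition $V=V_1\cup V_2$ with $V_1,V_2\ne\emptyset$ such that every edge meets $V_1$ in an odd number of vertices. -}

module Defs where

open import Data.Nat using (ℕ; zero; suc; _+_; _≡ᵇ_)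
open import Data.Nat.DivMod using (_%_)
open import Data.Bool using (Bool; if_then_else_)
open import Data.Fin using (Fin; toℕ)
open import Data.Fin.Subset using (Subset; _∩_; ∣_∣; Nonempty; ∁)
open import Data.List using (List; []; map; allFin; upTo)
open import Data.Nat.ListAction using (sum)
open import Data.Bool.ListAction using (any)
open import Data.List.Relation.Unary.All using (All)
open import Data.Vec using (tabulate; lookup)
open import Data.Product using (Σ; _×_)
open import Data.Sum using (_⊎_)
open import Relation.Binary.PropositionalEquality using (_≡_)

record Hypergraph (n : ℕ) : Set where
  field
    edges : List (Subset n)
open Hypergraph public

degree : ∀ {n} → Hypergraph n → Fin n → ℕ
degree H v = sum (map (λ e → if lookup e v then 1 else 0) (edges H))

Regular : ∀ {n} → Hypergraph n → Set
Regular H = ∀ u v → degree H u ≡ degree H v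

OddBipartite : ∀ {n} → Hypergraph n → Set
OddBipartite {n} H =
  edges H ≡ [] ⊎
  Σ (Subset n) (λ V₁ → Nonempty V₁ × Nonempty (∁ V₁) ×
      All (λ e → ∣ e ∩ V₁ ∣ % 2 ≡ 1) (edges H))

-- reduction mod n (n = 0 never used in the statement since n ≥ k+1 ≥ 1)
modN : ℕ → ℕ → ℕ
modN zero x = x
modN (suc n) x = x % suc n

tightEdge : (n k : ℕ) → Fin n → Subset n
tightEdge n k j = tabulate (λ v → any (λ i → modN n (toℕ j + 1 + i) ≡ᵇ toℕ v) (upTo k))

tightCycle : (n k : ℕ) → Hypergraph n
tightCycle n k = record { edges = map (tightEdge n k) (allFin n) }

module Submission where

-- Vertex v lies in exactly the k edges starting at v - k, …, v - 1, so the cycle is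
-- regular. Given an odd bipartition V₁, its indicator χ, extended N-periodically to ℕ,
-- has odd sum over every window of k consecutive places. Summing the N windows that
-- start in one period counts each place k times, so N ≡ k · ∑χ ≡ 0 (mod 2) for even k;
-- adding χ over consecutive pairs then yields a sequence of period N/2 whose windows of
-- length k/2 are odd, and induction on t₀ gives 2^t₀ ∣ N. Conversely, if d = 2^t₀ ∣ N
-- (t₀ ≥ 1 as k is even), the multiples of d meet every window of length k = d(2l₀+1)
-- in exactly 2l₀ + 1 places.

open import Defs
open import Data.Bool using (Bool; true; false; T; _∧_; not; if_then_else_)
open import Data.Bool.Properties using (T-≡)
open import Data.Bool.ListAction using (any)
open import Data.Empty using (⊥-elim)
open import Data.Fin using (Fin; toℕ; fromℕ<) renaming (zero to fzero; suc to fsuc)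
open import Data.Fin.Properties using (toℕ-injective; toℕ-fromℕ<; toℕ<n)
open import Data.Fin.Subset using (Subset; _∩_; ∣_∣; ∁)
open import Data.List using (map; upTo; allFin; tabulate)
open import Data.List.Membership.Propositional using (find; lose)
open import Data.List.Membership.Propositional.Properties using (∈-upTo⁺; ∈-upTo⁻; ∈-map⁺; ∈-allFin)
open import Data.List.Properties using (map-∘; map-tabulate)
open import Data.List.Relation.Unary.All using (All)
import Data.List.Relation.Unary.All as All
open import Data.List.Relation.Unary.All.Properties using (map⁺; tabulate⁺)
open import Data.List.Relation.Unary.Any.Properties using (any⁺; any⁻)
open import Data.Nat
open import Data.Nat.DivMod
open import Data.Nat.Divisibility using (_∣_; 1∣_; *-monoʳ-∣; m%n≡0⇒n∣m; n∣m⇒m%n≡0; ∣⇒≤)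
open import Data.Nat.ListAction using (sum)
open import Data.Nat.Properties
open import Data.Nat.Tactic.RingSolver using (solve-∀)
open import Data.Product using (_×_; _,_)
open import Data.Sum using (inj₂)
import Data.Vec as Vec
open import Data.Vec.Properties using (lookup∘tabulate; lookup-map; lookup-zipWith; lookup⇒[]=)
open import Function.Base using (_∘′_)
open import Function.Bundles using (_⇔_; mk⇔; Equivalence)
open import Relation.Binary.PropositionalEquality

∑< : ℕ → (ℕ → ℕ) → ℕ
∑< zero    f = 0
∑< (suc n) f = ∑< n f + f n

syntax ∑< n (λ i → e) = ∑[ i < n ] e

∑-cong : ∀ n {f g : ℕ → ℕ} → (∀ {i} → i < n → f i ≡ g i) → ∑< n f ≡ ∑< n g
∑-cong zero    eq = refl
∑-cong (suc n) eq = cong₂ _+_ (∑-cong n (eq ∘′ m<n⇒m<1+n)) (eq ≤-refl)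

∑-cong-% : ∀ d .{{_ : NonZero d}} n {f g : ℕ → ℕ} →
           (∀ i → f i % d ≡ g i % d) → ∑< n f % d ≡ ∑< n g % d
∑-cong-% d zero    eq = refl
∑-cong-% d (suc n) {f} {g} eq = begin
  (∑< n f + f n) % d                 ≡⟨ %-distribˡ-+ (∑< n f) (f n) d ⟩
  (∑< n f % d + f n % d) % d         ≡⟨ cong₂ (λ x y → (x + y) % d) (∑-cong-% d n eq) (eq n) ⟩
  (∑< n g % d + g n % d) % d         ≡⟨ %-distribˡ-+ (∑< n g) (g n) d ⟨
  (∑< n g + g n) % d                 ∎
  where open ≡-Reasoning

∑-suc : ∀ n (f : ℕ → ℕ) → ∑< (suc n) f ≡ f 0 + ∑[ i < n ] f (suc i)
∑-suc zero    f = +-comm 0 (f 0)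
∑-suc (suc n) f = trans (cong (_+ f (suc n)) (∑-suc n f)) (+-assoc (f 0) _ _)

∑-+ : ∀ m n (f : ℕ → ℕ) → ∑< (m + n) f ≡ ∑< m f + ∑[ i < n ] f (m + i)
∑-+ m zero    f = trans (cong (λ l → ∑< l f) (+-identityʳ m)) (sym (+-identityʳ _))
∑-+ m (suc n) f = begin
  ∑< (m + suc n) f                                ≡⟨ cong (λ l → ∑< l f) (+-suc m n) ⟩
  ∑< (m + n) f + f (m + n)                        ≡⟨ cong (_+ f (m + n)) (∑-+ m n f) ⟩
  ∑< m f + ∑[ i < n ] f (m + i) + f (m + n)       ≡⟨ +-assoc (∑< m f) _ _ ⟩
  ∑< m f + (∑[ i < n ] f (m + i) + f (m + n))     ∎
  where open ≡-Reasoning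

∑-const : ∀ n c → ∑< n (λ _ → c) ≡ n * c
∑-const zero    c = refl
∑-const (suc n) c = trans (cong (_+ c) (∑-const n c)) (+-comm (n * c) c)

∑-* : ∀ q m (f : ℕ → ℕ) → ∑< (q * m) f ≡ ∑[ j < q ] ∑[ i < m ] f (j * m + i)
∑-* zero    m f = refl
∑-* (suc q) m f = begin
  ∑< (m + q * m) f                                ≡⟨ cong (λ l → ∑< l f) (+-comm m (q * m)) ⟩
  ∑< (q * m + m) f                                ≡⟨ ∑-+ (q * m) m f ⟩
  ∑< (q * m) f + ∑[ i < m ] f (q * m + i)         ≡⟨ cong (_+ ∑[ i < m ] f (q * m + i)) (∑-* q m f) ⟩
  ∑[ j < suc q ] ∑[ i < m ] f (j * m + i)         ∎
  where open ≡-Reasoning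

∑-pairs : ∀ m (g : ℕ → ℕ) → ∑< (2 * m) g ≡ ∑[ i < m ] (g (2 * i) + g (suc (2 * i)))
∑-pairs zero    g = refl
∑-pairs (suc m) g = begin
  ∑< (2 * suc m) g                                ≡⟨ cong (λ l → ∑< l g) (*-suc 2 m) ⟩
  ∑< (2 * m) g + g (2 * m) + g (suc (2 * m))      ≡⟨ +-assoc (∑< (2 * m) g) _ _ ⟩
  ∑< (2 * m) g + (g (2 * m) + g (suc (2 * m)))    ≡⟨ cong (_+ (g (2 * m) + g (suc (2 * m)))) (∑-pairs m g) ⟩
  ∑[ i < suc m ] (g (2 * i) + g (suc (2 * i)))    ∎
  where open ≡-Reasoning

∑-reverse : ∀ n (f : ℕ → ℕ) → ∑[ j < n ] f (n ∸ suc j) ≡ ∑< n f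
∑-reverse zero    f = refl
∑-reverse (suc n) f = begin
  ∑[ j < suc n ] f (suc n ∸ suc j)    ≡⟨ ∑-suc n _ ⟩
  f n + ∑[ j < n ] f (n ∸ suc j)      ≡⟨ cong (f n +_) (∑-reverse n f) ⟩
  f n + ∑< n f                        ≡⟨ +-comm (f n) _ ⟩
  ∑< (suc n) f                        ∎
  where open ≡-Reasoning

Periodic : ℕ → (ℕ → ℕ) → Set
Periodic n f = ∀ x → f (x + n) ≡ f x

∑-shift-periodic : ∀ {n f} → Periodic n f → ∀ c → ∑[ i < n ] f (c + i) ≡ ∑< n f
∑-shift-periodic         per zero    = refl
∑-shift-periodic {n} {f} per (suc c) = begin
  ∑[ i < n ] f (suc c + i)    ≡⟨ ∑-cong n (λ {i} _ → cong f (sym (+-suc c i))) ⟩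
  ∑[ i < n ] f (c + suc i)    ≡⟨ shift-by-one ⟩
  ∑[ i < n ] f (c + i)        ≡⟨ ∑-shift-periodic per c ⟩
  ∑< n f                      ∎
  where
  open ≡-Reasoning
  shift-by-one : ∑[ i < n ] f (c + suc i) ≡ ∑[ i < n ] f (c + i)
  shift-by-one = +-cancelˡ-≡ (f (c + 0)) _ _ (begin
    f (c + 0) + ∑[ i < n ] f (c + suc i)    ≡⟨ ∑-suc n (λ i → f (c + i)) ⟨
    ∑[ i < n ] f (c + i) + f (c + n)        ≡⟨ cong (λ x → ∑[ i < n ] f (c + i) + f (x + n)) (sym (+-identityʳ c)) ⟩
    ∑[ i < n ] f (c + i) + f (c + 0 + n)    ≡⟨ cong (∑[ i < n ] f (c + i) +_) (per (c + 0)) ⟩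
    ∑[ i < n ] f (c + i) + f (c + 0)        ≡⟨ +-comm _ (f (c + 0)) ⟩
    f (c + 0) + ∑[ i < n ] f (c + i)        ∎)

𝟙 : Bool → ℕ
𝟙 b = if b then 1 else 0

T-⇔⇒≡ : ∀ {a b} → (T a → T b) → (T b → T a) → a ≡ b
T-⇔⇒≡ {false} {false} _ _ = refl
T-⇔⇒≡ {false} {true}  _ f = ⊥-elim (f _)
T-⇔⇒≡ {true}  {false} t _ = ⊥-elim (t _)
T-⇔⇒≡ {true}  {true}  _ _ = refl

𝟙-∧ : ∀ a b → 𝟙 (a ∧ b) ≡ 𝟙 a * 𝟙 b
𝟙-∧ true  b = sym (+-identityʳ (𝟙 b))
𝟙-∧ false b = refl

∑-truncate : ∀ {k n} (f : ℕ → ℕ) → k ≤ n → ∑[ i < n ] (𝟙 (i <ᵇ k) * f i) ≡ ∑< k f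
∑-truncate {k} {n} f k≤n = begin
  ∑[ i < n ] (𝟙 (i <ᵇ k) * f i)                       ≡⟨ cong (λ l → ∑[ i < l ] (𝟙 (i <ᵇ k) * f i)) (m+[n∸m]≡n k≤n) ⟨
  ∑[ i < k + (n ∸ k) ] (𝟙 (i <ᵇ k) * f i)             ≡⟨ ∑-+ k (n ∸ k) _ ⟩
  ∑[ i < k ] (𝟙 (i <ᵇ k) * f i)
    + ∑[ i < n ∸ k ] (𝟙 (k + i <ᵇ k) * f (k + i))   ≡⟨ cong₂ _+_ (∑-cong k below) (∑-cong (n ∸ k) (λ _ → above _)) ⟩
  ∑< k f + ∑< (n ∸ k) (λ _ → 0)                      ≡⟨ cong (∑< k f +_) (trans (∑-const (n ∸ k) 0) (*-zeroʳ (n ∸ k))) ⟩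
  ∑< k f + 0                                         ≡⟨ +-identityʳ _ ⟩
  ∑< k f                                             ∎
  where
  open ≡-Reasoning
  below : ∀ {i} → i < k → 𝟙 (i <ᵇ k) * f i ≡ f i
  below {i} i<k rewrite T-≡ .Equivalence.to (<⇒<ᵇ i<k) = +-identityʳ (f i)
  above : ∀ i → 𝟙 (k + i <ᵇ k) * f (k + i) ≡ 0
  above i with k + i <ᵇ k in eq
  ... | false = refl
  ... | true  = ⊥-elim (m+n≮m k i (<ᵇ⇒< (k + i) k (subst T (sym eq) _)))

OddWindows : ℕ → (ℕ → ℕ) → Set
OddWindows k f = ∀ a → ∑[ i < k ] f (a + i) % 2 ≡ 1

-- Modulo 2, both sides are ∑ f over n * k consecutive places, cut into n windows or into k periods.
period≡length*sum-mod-2 : ∀ {n k f} → Periodic n f → OddWindows k f → n % 2 ≡ (k * ∑< n f) % 2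
period≡length*sum-mod-2 {n} {k} {f} per odd = begin
  n % 2                                          ≡⟨ cong (_% 2) (trans (sym (*-identityʳ n)) (sym (∑-const n 1))) ⟩
  ∑< n (λ _ → 1) % 2                             ≡⟨ ∑-cong-% 2 n (λ j → sym (odd (j * k))) ⟩
  ∑[ j < n ] ∑[ i < k ] f (j * k + i) % 2        ≡⟨ cong (_% 2) (∑-* n k f) ⟨
  ∑< (n * k) f % 2                               ≡⟨ cong (λ l → ∑< l f % 2) (*-comm n k) ⟩
  ∑< (k * n) f % 2                               ≡⟨ cong (_% 2) (∑-* k n f) ⟩
  ∑[ j < k ] ∑[ i < n ] f (j * n + i) % 2        ≡⟨ cong (_% 2) (∑-cong k (λ {j} _ → ∑-shift-periodic per (j * n))) ⟩
  ∑< k (λ _ → ∑< n f) % 2                        ≡⟨ cong (_% 2) (∑-const k (∑< n f)) ⟩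
  (k * ∑< n f) % 2                               ∎
  where open ≡-Reasoning

pairSums : (ℕ → ℕ) → ℕ → ℕ
pairSums f i = f (2 * i) + f (suc (2 * i))

pairSums-periodic : ∀ {n f} → Periodic (2 * n) f → Periodic n (pairSums f)
pairSums-periodic {n} {f} per x =
  cong₂ _+_ (trans (cong f double) (per (2 * x)))
            (trans (cong (λ y → f (suc y)) double) (per (suc (2 * x))))
  where
  double : 2 * (x + n) ≡ 2 * x + 2 * n
  double = *-distribˡ-+ 2 x n

pairSums-oddWindows : ∀ {k f} → OddWindows (2 * k) f → OddWindows k (pairSums f)
pairSums-oddWindows {k} {f} odd a = begin
  ∑[ i < k ] pairSums f (a + i) % 2                            ≡⟨ cong (_% 2) (∑-cong k (λ {i} _ → regroup i)) ⟩
  ∑[ i < k ] (f (2 * a + 2 * i) + f (2 * a + suc (2 * i))) % 2  ≡⟨ cong (_% 2) (∑-pairs k (λ i → f (2 * a + i))) ⟨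
  ∑[ i < 2 * k ] f (2 * a + i) % 2                              ≡⟨ odd (2 * a) ⟩
  1                                                             ∎
  where
  open ≡-Reasoning
  regroup : ∀ i → pairSums f (a + i) ≡ f (2 * a + 2 * i) + f (2 * a + suc (2 * i))
  regroup i = cong₂ _+_ (cong f (*-distribˡ-+ 2 a i))
                        (cong f (trans (cong suc (*-distribˡ-+ 2 a i)) (sym (+-suc (2 * a) (2 * i)))))

oddWindows⇒2^t∣period : ∀ t l {n f} → Periodic n f → OddWindows (2 ^ t * (2 * l + 1)) f → 2 ^ t ∣ n
oddWindows⇒2^t∣period zero    l {n}     per odd = 1∣ n
oddWindows⇒2^t∣period (suc t) l {n} {f} per odd =
  subst (2 ^ suc t ∣_) 2*h≡n (*-monoʳ-∣ 2 2^t∣h)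
  where
  k = 2 ^ t * (2 * l + 1)
  s = ∑< n f
  odd′ : OddWindows (2 * k) f
  odd′ = subst (λ k → OddWindows k f) (*-assoc 2 (2 ^ t) (2 * l + 1)) odd
  n-even : n % 2 ≡ 0
  n-even = trans (period≡length*sum-mod-2 {k = 2 * k} {f} per odd′)
                 (trans (cong (_% 2) (trans (*-assoc 2 k s) (*-comm 2 (k * s)))) (m*n%n≡0 (k * s) 2))
  h = n / 2
  2*h≡n : 2 * h ≡ n
  2*h≡n = m*[n/m]≡n (m%n≡0⇒n∣m n 2 n-even)
  per′ : Periodic (2 * h) f
  per′ = subst (λ p → Periodic p f) (sym 2*h≡n) per
  2^t∣h : 2 ^ t ∣ h
  2^t∣h = oddWindows⇒2^t∣period t l (pairSums-periodic {h} per′) (pairSums-oddWindows {k} {f} odd′)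

[m%d+n]%d≡[m+n]%d : ∀ m n d .{{_ : NonZero d}} → (m % d + n) % d ≡ (m + n) % d
[m%d+n]%d≡[m+n]%d m n d = begin
  (m % d + n) % d              ≡⟨ %-distribˡ-+ (m % d) n d ⟩
  (m % d % d + n % d) % d      ≡⟨ cong (λ x → (x + n % d) % d) (m%n%n≡m%n m d) ⟩
  (m % d + n % d) % d          ≡⟨ %-distribˡ-+ m n d ⟨
  (m + n) % d                  ∎
  where open ≡-Reasoning

%-cong-+ʳ : ∀ {m n} o d .{{_ : NonZero d}} → m % d ≡ n % d → (m + o) % d ≡ (n + o) % d
%-cong-+ʳ {m} {n} o d eq = begin
  (m + o) % d              ≡⟨ %-distribˡ-+ m o d ⟩
  (m % d + o % d) % d      ≡⟨ cong (λ x → (x + o % d) % d) eq ⟩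
  (n % d + o % d) % d      ≡⟨ %-distribˡ-+ n o d ⟨
  (n + o) % d              ∎
  where open ≡-Reasoning

-- Adding d ∸ a % d to both sides turns a + i into i + d.
+-cancelˡ-% : ∀ a {i j d} .{{_ : NonZero d}} → i < d → j < d → (a + i) % d ≡ (a + j) % d → i ≡ j
+-cancelˡ-% a {i} {j} {d} i<d j<d eq = begin
  i                        ≡⟨ m<n⇒m%n≡m i<d ⟨
  i % d                    ≡⟨ [m+n]%n≡m%n i d ⟨
  (i + d) % d              ≡⟨ cong (_% d) (complement i) ⟨
  (r + i + (d ∸ r)) % d    ≡⟨ %-cong-+ʳ (d ∸ r) d reduced ⟩
  (r + j + (d ∸ r)) % d    ≡⟨ cong (_% d) (complement j) ⟩
  (j + d) % d              ≡⟨ [m+n]%n≡m%n j d ⟩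
  j % d                    ≡⟨ m<n⇒m%n≡m j<d ⟩
  j                        ∎
  where
  open ≡-Reasoning
  r = a % d
  complement : ∀ x → r + x + (d ∸ r) ≡ x + d
  complement x = trans (cong (_+ (d ∸ r)) (+-comm r x))
                       (trans (+-assoc x r (d ∸ r)) (cong (x +_) (m+[n∸m]≡n (m%n≤n a d))))
  reduced : (r + i) % d ≡ (r + j) % d
  reduced = trans ([m%d+n]%d≡[m+n]%d a i d) (trans eq (sym ([m%d+n]%d≡[m+n]%d a j d)))

[2l+1]%2≡1 : ∀ l → (2 * l + 1) % 2 ≡ 1
[2l+1]%2≡1 l = trans (cong (_% 2) (trans (+-comm (2 * l) 1) (cong suc (*-comm 2 l)))) ([m+kn]%n≡m%n 1 l 2)

∑-multiples-one : ∀ d .{{_ : NonZero d}} → ∑[ i < d ] 𝟙 (i % d ≡ᵇ 0) ≡ 1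
∑-multiples-one (suc d) = trans (∑-suc d _) (cong suc (trans (∑-cong d nonMultiple) (trans (∑-const d 0) (*-zeroʳ d))))
  where
  nonMultiple : ∀ {i} → i < d → 𝟙 (suc i % suc d ≡ᵇ 0) ≡ 0
  nonMultiple i<d = cong (λ x → 𝟙 (x ≡ᵇ 0)) (m<n⇒m%n≡m (s<s i<d))

∑-multiples : ∀ d .{{_ : NonZero d}} q a → ∑[ i < q * d ] 𝟙 ((a + i) % d ≡ᵇ 0) ≡ q
∑-multiples d q a = begin
  ∑[ i < q * d ] Z (a + i)                    ≡⟨ ∑-* q d (λ i → Z (a + i)) ⟩
  ∑[ j < q ] ∑[ i < d ] Z (a + (j * d + i))   ≡⟨ ∑-cong q (λ {j} _ → block j) ⟩
  ∑< q (λ _ → 1)                              ≡⟨ trans (∑-const q 1) (*-identityʳ q) ⟩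
  q                                           ∎
  where
  open ≡-Reasoning
  Z : ℕ → ℕ
  Z v = 𝟙 (v % d ≡ᵇ 0)
  block : ∀ j → ∑[ i < d ] Z (a + (j * d + i)) ≡ 1
  block j = begin
    ∑[ i < d ] Z (a + (j * d + i))    ≡⟨ ∑-cong d (λ {i} _ → cong Z (sym (+-assoc a (j * d) i))) ⟩
    ∑[ i < d ] Z (a + j * d + i)      ≡⟨ ∑-shift-periodic (λ y → cong (λ x → 𝟙 (x ≡ᵇ 0)) ([m+n]%n≡m%n y d)) (a + j * d) ⟩
    ∑< d Z                            ≡⟨ ∑-multiples-one d ⟩
    1                                 ∎

sum-tabulate≡∑ : ∀ n (g : Fin n → ℕ) (h : ℕ → ℕ) → (∀ i → g i ≡ h (toℕ i)) → sum (tabulate g) ≡ ∑< n h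
sum-tabulate≡∑ zero    g h eq = refl
sum-tabulate≡∑ (suc n) g h eq =
  trans (cong₂ _+_ (eq fzero) (sum-tabulate≡∑ n (λ i → g (fsuc i)) (λ x → h (suc x)) (λ i → eq (fsuc i))))
        (sym (∑-suc n h))

∣p∣≡∑ : ∀ n (p : Subset n) (h : ℕ → ℕ) → (∀ i → 𝟙 (Vec.lookup p i) ≡ h (toℕ i)) → ∣ p ∣ ≡ ∑< n h
∣p∣≡∑ zero    Vec.[]          h eq = refl
∣p∣≡∑ (suc n) (true  Vec.∷ p) h eq =
  trans (cong₂ _+_ (eq fzero) (∣p∣≡∑ n p (λ x → h (suc x)) (λ i → eq (fsuc i)))) (sym (∑-suc n h))
∣p∣≡∑ (suc n) (false Vec.∷ p) h eq =
  trans (cong₂ _+_ (eq fzero) (∣p∣≡∑ n p (λ x → h (suc x)) (λ i → eq (fsuc i)))) (sym (∑-suc n h))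

module TightCycle (m k : ℕ) (k<N : k < suc m) where

  N : ℕ
  N = suc m

  window : ℕ → ℕ → Bool
  window a v = any (λ i → (a + i) % N ≡ᵇ v) (upTo k)

  lookup-tightEdge : ∀ j v → Vec.lookup (tightEdge N k j) v ≡ window (toℕ j + 1) (toℕ v)
  lookup-tightEdge j v = lookup∘tabulate (λ v → window (toℕ j + 1) (toℕ v)) v

  window-at : ∀ a {i} → i < N → window a ((a + i) % N) ≡ (i <ᵇ k)
  window-at a {i} i<N = T-⇔⇒≡ in-window⇒<k <k⇒in-window
    where
    in-window⇒<k : T (window a ((a + i) % N)) → T (i <ᵇ k)
    in-window⇒<k w with i′ , i′∈ , hit ← find (any⁻ _ (upTo k) w) =
      <⇒<ᵇ (subst (_< k) (+-cancelˡ-% a (<-trans (∈-upTo⁻ i′∈) k<N) i<N (≡ᵇ⇒≡ _ _ hit)) (∈-upTo⁻ i′∈))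
    <k⇒in-window : T (i <ᵇ k) → T (window a ((a + i) % N))
    <k⇒in-window i<k = any⁺ _ (lose (∈-upTo⁺ (<ᵇ⇒< i k i<k)) (≡⇒≡ᵇ ((a + i) % N) _ refl))

  window-offset : ∀ {a v} → a ≤ N → v < N → window a v ≡ ((v + (N ∸ a)) % N <ᵇ k)
  window-offset {a} {v} a≤N v<N =
    trans (cong (window a) (sym lands-on-v)) (window-at a (m%n<n (v + (N ∸ a)) N))
    where
    lands-on-v : (a + (v + (N ∸ a)) % N) % N ≡ v
    lands-on-v = begin
      (a + (v + (N ∸ a)) % N) % N    ≡⟨ cong (_% N) (+-comm a _) ⟩
      ((v + (N ∸ a)) % N + a) % N    ≡⟨ [m%d+n]%d≡[m+n]%d (v + (N ∸ a)) a N ⟩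
      (v + (N ∸ a) + a) % N          ≡⟨ cong (_% N) (trans (+-assoc v _ a) (cong (v +_) (m∸n+n≡m a≤N))) ⟩
      (v + N) % N                    ≡⟨ [m+n]%n≡m%n v N ⟩
      v % N                          ≡⟨ m<n⇒m%n≡m v<N ⟩
      v                              ∎
      where open ≡-Reasoning

  degree-tightCycle : ∀ v → degree (tightCycle N k) v ≡ k
  degree-tightCycle v = begin
    degree (tightCycle N k) v                           ≡⟨ cong sum (sym (map-∘ (allFin N))) ⟩
    sum (map (λ j → 𝟙 (Vec.lookup (tightEdge N k j) v)) (allFin N))
      ≡⟨ cong sum (map-tabulate (λ j → j) (λ j → 𝟙 (Vec.lookup (tightEdge N k j) v))) ⟩
    sum (tabulate (λ j → 𝟙 (Vec.lookup (tightEdge N k j) v)))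
      ≡⟨ sum-tabulate≡∑ N _ (λ j → 𝟙 (window (j + 1) (toℕ v))) (λ j → cong 𝟙 (lookup-tightEdge j v)) ⟩
    ∑[ j < N ] 𝟙 (window (j + 1) (toℕ v))              ≡⟨ ∑-cong N (λ j<N → cong 𝟙 (offset j<N)) ⟩
    ∑[ j < N ] F (toℕ v + (N ∸ suc j))                  ≡⟨ ∑-reverse N (λ j → F (toℕ v + j)) ⟩
    ∑[ j < N ] F (toℕ v + j)                            ≡⟨ ∑-shift-periodic F-periodic (toℕ v) ⟩
    ∑< N F                                              ≡⟨ ∑-cong N (λ y<N → F-below y<N) ⟩
    ∑[ y < N ] (𝟙 (y <ᵇ k) * 1)                         ≡⟨ ∑-truncate (λ _ → 1) (<⇒≤ k<N) ⟩
    ∑< k (λ _ → 1)                                      ≡⟨ trans (∑-const k 1) (*-identityʳ k) ⟩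
    k                                                   ∎
    where
    open ≡-Reasoning
    F : ℕ → ℕ
    F y = 𝟙 (y % N <ᵇ k)
    F-periodic : Periodic N F
    F-periodic y = cong (λ x → 𝟙 (x <ᵇ k)) ([m+n]%n≡m%n y N)
    F-below : ∀ {y} → y < N → F y ≡ 𝟙 (y <ᵇ k) * 1
    F-below y<N = trans (cong (λ x → 𝟙 (x <ᵇ k)) (m<n⇒m%n≡m y<N)) (sym (*-identityʳ _))
    offset : ∀ {j} → j < N → window (j + 1) (toℕ v) ≡ ((toℕ v + (N ∸ suc j)) % N <ᵇ k)
    offset {j} j<N = trans (window-offset (subst (_≤ N) (+-comm 1 j) j<N) (toℕ<n v))
                           (cong (λ x → (toℕ v + (N ∸ x)) % N <ᵇ k) (+-comm j 1))

  χ : Subset N → ℕ → ℕ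
  χ p v = 𝟙 (Vec.lookup p (v mod N))

  χ-cong : ∀ p {x y} → x % N ≡ y % N → χ p x ≡ χ p y
  χ-cong p eq = cong (λ i → 𝟙 (Vec.lookup p i)) (toℕ-injective (trans (toℕ-fromℕ< _) (trans eq (sym (toℕ-fromℕ< _)))))

  χ-periodic : ∀ p → Periodic N (χ p)
  χ-periodic p y = χ-cong p {y + N} {y} ([m+n]%n≡m%n y N)

  χ-toℕ : ∀ p i → 𝟙 (Vec.lookup p i) ≡ χ p (toℕ i)
  χ-toℕ p i = cong (λ j → 𝟙 (Vec.lookup p j)) (sym (toℕ-injective (trans (toℕ-fromℕ< _) (m<n⇒m%n≡m (toℕ<n i)))))

  ∣tightEdge∩p∣≡∑χ : ∀ j p → ∣ tightEdge N k j ∩ p ∣ ≡ ∑[ i < k ] χ p (toℕ j + 1 + i)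
  ∣tightEdge∩p∣≡∑χ j p = begin
    ∣ tightEdge N k j ∩ p ∣                     ≡⟨ ∣p∣≡∑ N (tightEdge N k j ∩ p) g lookup-∩ ⟩
    ∑< N g                                      ≡⟨ ∑-shift-periodic g-periodic a ⟨
    ∑[ i < N ] g (a + i)                        ≡⟨ ∑-cong N (λ {i} i<N → cong (λ b → 𝟙 b * χ p (a + i)) (window-at a i<N)) ⟩
    ∑[ i < N ] (𝟙 (i <ᵇ k) * χ p (a + i))       ≡⟨ ∑-truncate (λ i → χ p (a + i)) (<⇒≤ k<N) ⟩
    ∑[ i < k ] χ p (a + i)                      ∎
    where
    open ≡-Reasoning
    a = toℕ j + 1
    g : ℕ → ℕ
    g v = 𝟙 (window a (v % N)) * χ p v
    g-periodic : Periodic N g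
    g-periodic y = cong₂ _*_ (cong (λ x → 𝟙 (window a x)) ([m+n]%n≡m%n y N)) (χ-periodic p y)
    lookup-∩ : ∀ i → 𝟙 (Vec.lookup (tightEdge N k j ∩ p) i) ≡ g (toℕ i)
    lookup-∩ i = begin
      𝟙 (Vec.lookup (tightEdge N k j ∩ p) i)                          ≡⟨ cong 𝟙 (lookup-zipWith _∧_ i (tightEdge N k j) p) ⟩
      𝟙 (Vec.lookup (tightEdge N k j) i ∧ Vec.lookup p i)             ≡⟨ 𝟙-∧ (Vec.lookup (tightEdge N k j) i) (Vec.lookup p i) ⟩
      𝟙 (Vec.lookup (tightEdge N k j) i) * 𝟙 (Vec.lookup p i)
        ≡⟨ cong₂ _*_ (cong 𝟙 (trans (lookup-tightEdge j i) (cong (window a) (sym (m<n⇒m%n≡m (toℕ<n i)))))) (χ-toℕ p i) ⟩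
      g (toℕ i)                                                       ∎

  tightEdge-odd⇒oddWindows : ∀ p → All (λ e → ∣ e ∩ p ∣ % 2 ≡ 1) (edges (tightCycle N k)) → OddWindows k (χ p)
  tightEdge-odd⇒oddWindows p odd-edges a = begin
    ∑[ i < k ] χ p (a + i) % 2                ≡⟨ cong (_% 2) (∑-cong k (λ {i} _ → χ-cong p {a + i} {toℕ j + 1 + i} (same-place i))) ⟩
    ∑[ i < k ] χ p (toℕ j + 1 + i) % 2        ≡⟨ cong (_% 2) (∣tightEdge∩p∣≡∑χ j p) ⟨
    ∣ tightEdge N k j ∩ p ∣ % 2               ≡⟨ All.lookup odd-edges (∈-map⁺ (tightEdge N k) (∈-allFin j)) ⟩
    1                                         ∎
    where
    open ≡-Reasoning
    -- edge j starts at j + 1 ≡ a (mod N)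
    j : Fin N
    j = (a + m) mod N
    same-place : ∀ i → (a + i) % N ≡ (toℕ j + 1 + i) % N
    same-place i = sym (begin
      (toℕ j + 1 + i) % N            ≡⟨ cong (λ x → (x + 1 + i) % N) (toℕ-fromℕ< (m%n<n (a + m) N)) ⟩
      ((a + m) % N + 1 + i) % N      ≡⟨ cong (_% N) (+-assoc ((a + m) % N) 1 i) ⟩
      ((a + m) % N + (1 + i)) % N    ≡⟨ [m%d+n]%d≡[m+n]%d (a + m) (1 + i) N ⟩
      (a + m + (1 + i)) % N          ≡⟨ cong (_% N) (rearrange a m i) ⟩
      (a + i + N) % N                ≡⟨ [m+n]%n≡m%n (a + i) N ⟩
      (a + i) % N                    ∎)
      where
      rearrange : ∀ a m i → a + m + (1 + i) ≡ a + i + suc m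
      rearrange = solve-∀

  oddBipartite⇒2^t∣N : ∀ t l → k ≡ 2 ^ t * (2 * l + 1) → OddBipartite (tightCycle N k) → 2 ^ t ∣ N
  oddBipartite⇒2^t∣N t l k≡ (inj₂ (p , _ , _ , odd-edges)) =
    oddWindows⇒2^t∣period t l (χ-periodic p) (subst (λ k → OddWindows k (χ p)) k≡ (tightEdge-odd⇒oddWindows p odd-edges))

  multiplesOf : ∀ d .{{_ : NonZero d}} → Subset N
  multiplesOf d = Vec.tabulate (λ v → toℕ v % d ≡ᵇ 0)

  χ-multiplesOf : ∀ d .{{_ : NonZero d}} → d ∣ N → ∀ v → χ (multiplesOf d) v ≡ 𝟙 (v % d ≡ᵇ 0)
  χ-multiplesOf d d∣N v = cong 𝟙 (trans (lookup∘tabulate (λ v → toℕ v % d ≡ᵇ 0) (v mod N))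
    (cong (_≡ᵇ 0) (trans (cong (_% d) (toℕ-fromℕ< _)) (m∣n⇒o%n%m≡o%m d N v d∣N))))

  multiplesOf-oddBipartite : ∀ d .{{_ : NonZero d}} q → 1 < d → d ∣ N → k ≡ q * d → q % 2 ≡ 1 →
                             OddBipartite (tightCycle N k)
  multiplesOf-oddBipartite d q 1<d d∣N k≡ q-odd =
    inj₂ (V , (fzero , lookup⇒[]= fzero V 0∈V) , (one , lookup⇒[]= one (∁ V) 1∈∁V) ,
          map⁺ (tabulate⁺ {f = λ j → j} odd-edge))
    where
    V = multiplesOf d
    1<N : 1 < N
    1<N = <-≤-trans 1<d (∣⇒≤ d∣N)
    one : Fin N
    one = fromℕ< 1<N
    0∈V : Vec.lookup V fzero ≡ true
    0∈V = cong (_≡ᵇ 0) (m*n%n≡0 0 d)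
    1∈∁V : Vec.lookup (∁ V) one ≡ true
    1∈∁V = trans (lookup-map one not V) (cong not (trans (lookup∘tabulate (λ v → toℕ v % d ≡ᵇ 0) one)
            (trans (cong (λ x → x % d ≡ᵇ 0) (toℕ-fromℕ< 1<N)) (cong (_≡ᵇ 0) (m<n⇒m%n≡m 1<d)))))
    odd-edge : ∀ j → ∣ tightEdge N k j ∩ V ∣ % 2 ≡ 1
    odd-edge j = trans (cong (_% 2) (begin
      ∣ tightEdge N k j ∩ V ∣                     ≡⟨ ∣tightEdge∩p∣≡∑χ j V ⟩
      ∑[ i < k ] χ V (toℕ j + 1 + i)              ≡⟨ ∑-cong k (λ {i} _ → χ-multiplesOf d d∣N (toℕ j + 1 + i)) ⟩
      ∑[ i < k ] 𝟙 ((toℕ j + 1 + i) % d ≡ᵇ 0)     ≡⟨ cong (λ l → ∑[ i < l ] 𝟙 ((toℕ j + 1 + i) % d ≡ᵇ 0)) k≡ ⟩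
      ∑[ i < q * d ] 𝟙 ((toℕ j + 1 + i) % d ≡ᵇ 0) ≡⟨ ∑-multiples d q (toℕ j + 1) ⟩
      q                                           ∎)) q-odd
      where open ≡-Reasoning

corollary4p2 : (k n : ℕ) → 2 ∣ k → k + 1 ≤ n →
    Regular (tightCycle n k) ×
    ((t₀ l₀ : ℕ) → k ≡ 2 ^ t₀ * (2 * l₀ + 1) →
      (OddBipartite (tightCycle n k) ⇔ (2 ^ t₀ ∣ n)))
corollary4p2 k zero    _   k+1≤0 = ⊥-elim (m+n≮m 0 k (subst (_≤ 0) (+-comm k 1) k+1≤0))
corollary4p2 k (suc m) 2∣k k+1≤n =
  (λ u v → trans (degree-tightCycle u) (sym (degree-tightCycle v))) ,
  λ t l k≡ → mk⇔ (oddBipartite⇒2^t∣N t l k≡) (2^t∣N⇒oddBipartite t l k≡)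
  where
  open TightCycle m k (subst (_≤ suc m) (+-comm k 1) k+1≤n)
  2^t∣N⇒oddBipartite : ∀ t l → k ≡ 2 ^ t * (2 * l + 1) → 2 ^ t ∣ N → OddBipartite (tightCycle N k)
  2^t∣N⇒oddBipartite zero    l k≡ _ =
    ⊥-elim (0≢1+n (trans (sym (n∣m⇒m%n≡0 k 2 2∣k)) (trans (cong (_% 2) (trans k≡ (*-identityˡ _))) ([2l+1]%2≡1 l))))
  2^t∣N⇒oddBipartite (suc t) l k≡ d∣N =
    multiplesOf-oddBipartite (2 ^ suc t) {{m^n≢0 2 (suc t)}} (2 * l + 1) (*-monoʳ-≤ 2 (m^n>0 2 t)) d∣N
      (trans k≡ (*-comm (2 ^ suc t) _)) ([2l+1]%2≡1 l)
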